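{- Let $\varepsilon>0$ be sufficiently small and $(\mathcal K,E_{\mathrm{adm}})$ an $\varepsilon$-similar preclustering. For every $r\in V$ and every $v\in N_{\mathrm{cand}}(r)$, we have $|N_{\mathrm{cand}}(r)|=O(\varepsilon^{ -4}d(v))$.
   Context: Instance: vertex set $V$, every unordered pair labeled $+$edge or $-$edge; $d(v)$ is the number of $+$edges at $v$ (self-loops $uu$ count as $+$edges). Preclustering $(\mathcal K,E_{\mathrm{adm}})$: $\mathcal K$ a family of disjoint subsets of size $\ge2$ (non-singleton atoms), $V_{\mathcal K}=\bigcup\mathcal K$, other vertices singleton atoms; $K(v)$ the atom of $v$ ($\{v\}$ if singleton); $E_{\mathrm{adm}}$ admissible pairs, each with at least one endpoint outside $V_{\mathcal K}$; $N_{\mathrm{adm}}(v)$ the set of $u$ with $(u,v)\in E_{\mathrm{adm}}$, $d_{\mathrm{adm}}(v)=|N_{\mathrm{adm}}(v)|$. $\varepsilon$-similar: (a) $d_{\mathrm{adm}}(v)\le2\varepsilon^{ -3}d(v)$ for all $v$; (b) for $uv\in E_{\mathrm{adm}}$, $d(u)\le2\varepsilon^{ -1}d(v)$ and $u,v$ share at least $\varepsilon\min\{d(u),d(v)\}$ $+$neighbors degree similar to both ($w\tilde w$ degree similar iff $\varepsilon d(w)\le d(\tilde w)\le d(w)/\varepsilon$); (c) each $v\in K\in\mathcal K$ is $+$adjacent to at least a $(1-O(\varepsilon))$-fraction of $K$ and has at most $O(\varepsilon|K|)$ $+$neighbors outside $K$. $N_{\mathrm{cand}}(r)=N_{\mathrm{adm}}(r)\setminus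 V_{\mathcal K}$ if $r$ is a singleton atom, and $N_{\mathrm{cand}}(r)=K(r)\cup\bigcap_{u\in K(r)}N_{\mathrm{adm}}(u)$ otherwise. -}

module Defs where

open import Data.Nat as ℕ using (ℕ; _≥_)
open import Data.Integer using (+_)
open import Data.Rational.Unnormalised as ℚᵘ using (ℚᵘ; _/_; _≤_; _<_; _*_; _-_; _⊓_; 0ℚᵘ; 1ℚᵘ; _≤ᵇ_)
open import Data.Bool using (Bool; true; false; _∧_; _∨_; not; if_then_else_)
open import Data.Fin using (Fin)
open import Data.Fin.Subset using (Subset; _∈_; _∩_; _∪_; _─_; ∣_∣)
open import Data.Vec using (lookup; tabulate)
open import Data.List using (foldr; allFin)
open import Data.Product using (_×_)
open import Data.Sum using (_⊎_)
open import Relation.Binary.PropositionalEquality using (_≡_)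

ℚ[_] : ℕ → ℚᵘ
ℚ[ n ] = + n / 1

-- An instance on vertex set Fin n: plus v is the set of +neighbours of v.
-- Every pair not a +edge is a −edge. Self-loops count as +edges.
record Instance (n : ℕ) : Set where
  field
    plus     : Fin n → Subset n
    plus-sym : ∀ u v → u ∈ plus v → v ∈ plus u
    plus-refl : ∀ v → v ∈ plus v

module _ {n : ℕ} (G : Instance n) where
  open Instance G

  -- d(v): number of +edges at v (the self-loop vv included)
  deg : Fin n → ℕ
  deg v = ∣ plus v ∣

  -- degree similarity:  ε d(w) ≤ d(w') ≤ d(w)/ε   (ε > 0), written multiplied out
  degSimᵇ : ℚᵘ → Fin n → Fin n → Bool
  degSimᵇ ε w w' = (ε * ℚ[ deg w ] ≤ᵇ ℚ[ deg w' ]) ∧ (ε * ℚ[ deg w' ] ≤ᵇ ℚ[ deg w ])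

  goodCommon : ℚᵘ → Fin n → Fin n → Subset n
  goodCommon ε u v = tabulate (λ w → lookup (plus u) w ∧ lookup (plus v) w
                                      ∧ degSimᵇ ε w u ∧ degSimᵇ ε w v)

-- A preclustering.  The atom structure is given by the map atom : v ↦ K(v)
-- (a partition of Fin n into atoms); the non-singleton atoms form 𝒦.
record Preclustering (n : ℕ) : Set where
  field
    atom      : Fin n → Subset n
    atom-self : ∀ v → v ∈ atom v
    atom-cons : ∀ u v → u ∈ atom v → atom u ≡ atom v
    adm       : Fin n → Subset n
    adm-sym   : ∀ u v → u ∈ adm v → v ∈ adm u

  inVKᵇ : Fin n → Bool
  inVKᵇ v = 2 ℕ.≤ᵇ ∣ atom v ∣

  VK : Subset n
  VK = tabulate inVKᵇ

  AdmOK : Set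
  AdmOK = ∀ u v → u ∈ adm v → inVKᵇ u ≡ false ⊎ inVKᵇ v ≡ false

  d-adm : Fin n → ℕ
  d-adm v = ∣ adm v ∣

  -- ⋂_{u ∈ K(r)} N_adm(u)
  interAdm : Fin n → Subset n
  interAdm r = tabulate (λ w → foldr (λ u b → (not (lookup (atom r) u) ∨ lookup (adm u) w) ∧ b) true (allFin n))

  cand : Fin n → Subset n
  cand r = if inVKᵇ r then atom r ∪ interAdm r else adm r ─ VK

open Preclustering public

-- ε-similarity; C is the (fixed) constant hidden in the O(ε) terms of (c).
record EpsSimilar {n : ℕ} (G : Instance n) (P : Preclustering n) (C ε : ℚᵘ) : Set where
  open Instance G
  field
    adm-ok : AdmOK P
    condA : ∀ v → ε * ε * ε * ℚ[ d-adm P v ] ≤ ℚ[ 2 ] * ℚ[ deg G v ]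
    condB₁ : ∀ u v → u ∈ adm P v → ε * ℚ[ deg G u ] ≤ ℚ[ 2 ] * ℚ[ deg G v ]
    condB₂ : ∀ u v → u ∈ adm P v →
             ε * (ℚ[ deg G u ] ⊓ ℚ[ deg G v ]) ≤ ℚ[ ∣ goodCommon G ε u v ∣ ]
    condC₁ : ∀ v → inVKᵇ P v ≡ true →
             (1ℚᵘ - C * ε) * ℚ[ ∣ atom P v ∣ ] ≤ ℚ[ ∣ plus v ∩ atom P v ∣ ]
    condC₂ : ∀ v → inVKᵇ P v ≡ true →
             ℚ[ ∣ plus v ─ atom P v ∣ ] ≤ C * ε * ℚ[ ∣ atom P v ∣ ]

-- With Cε ≤ ½, condition (c) makes |K(v)| and d(v) agree up to a factor 2 on every
-- non-singleton atom, while a singleton atom has size 1 ≤ d(v) thanks to the self-loop.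
-- Since N_cand(r) ⊆ K(r) ∪ N_adm(r), condition (a) gives ε³|N_cand(r)| ≤ |K(r)| + 2d(r) ≤ 4d(r).
-- A candidate v is either admissible for r, and then ε d(r) ≤ 2d(v) by (b), or lies in the
-- atom of r, and then d(r) ≤ 2|K(r)| ≤ 4d(v). Multiplying, ε⁴|N_cand(r)| ≤ 16 d(v).

{-# OPTIONS --safe #-}
module Submission where

open import Defs
open import Data.Nat using (ℕ)
open import Data.Rational.Unnormalised using (ℚᵘ; _≤_; _<_; _*_; 0ℚᵘ)
open import Data.Fin using (Fin)
open import Data.Fin.Subset using (_∈_; ∣_∣)
open import Data.Product using (Σ; _×_; _,_)

open import Algebra.Bundles using (CommutativeMonoid)
open import Data.Bool using (Bool; true; false; _∧_; _∨_; not; T)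
open import Data.Fin.Subset using (Subset; _⊆_; _∩_; _∪_; _─_)
open import Data.Fin.Subset.Properties using (∣⁅x⁆∣≡1; x∈⁅y⁆⇒x≡y; ∣p∩q∣≤∣q∣; x∈p∪q⁻; p─q⊆p; p⊆q⇒∣p∣≤∣q∣; ∣p─q∣≤∣p∣; ∣p∩q∣≤∣p∣)
import Data.Integer as ℤ
import Data.Integer.Properties as ℤ
open import Data.List as List using (List; foldr; allFin)
open import Data.List.Membership.Propositional using () renaming (_∈_ to _∈ₗ_)
open import Data.List.Membership.Propositional.Properties using (∈-allFin)
open import Data.List.Relation.Unary.Any using (here; there)
import Data.Nat as ℕ
import Data.Nat.Properties as ℕ
open import Data.Rational.Unnormalised
  using (_/_; mkℚᵘ; *≤*; *<*; *≡*; _≃_; _+_; _-_; 1ℚᵘ; ½; ↥_; NonNegative; nonNegative)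
open import Data.Rational.Unnormalised.Properties
open import Data.Sum using (_⊎_; inj₁; inj₂)
open import Data.Vec using ([]; _∷_; lookup; tabulate)
open import Data.Vec.Properties using (lookup∘tabulate; []=⇒lookup; lookup⇒[]=)
open import Relation.Binary.PropositionalEquality using (_≡_; refl; sym; trans; cong; cong₂; subst)

open import Algebra.Properties.CommutativeSemigroup
  (CommutativeMonoid.commutativeSemigroup *-1-commutativeMonoid)
  using (x∙yz≈y∙xz; xy∙z≈y∙xz)

ℚ[]-mono-≤ : ∀ {m n} → m ℕ.≤ n → ℚ[ m ] ≤ ℚ[ n ]
ℚ[]-mono-≤ m≤n = *≤* (ℤ.*-monoʳ-≤-nonNeg (ℤ.+ 1) (ℤ.+≤+ m≤n))

ℚ[]-cancel-≤ : ∀ {m n} → ℚ[ m ] ≤ ℚ[ n ] → m ℕ.≤ n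
ℚ[]-cancel-≤ {m} {n} (*≤* m≤n) = ℤ.drop‿+≤+ (ℤ.*-cancelʳ-≤-pos (ℤ.+ m) (ℤ.+ n) (ℤ.+ 1) m≤n)

ℚ[]-+ : ∀ m n → ℚ[ m ℕ.+ n ] ≃ ℚ[ m ] + ℚ[ n ]
ℚ[]-+ m n = *≡* (cong (ℤ._* ℤ.+ 1) (trans (ℤ.pos-+ m n)
  (sym (cong₂ ℤ._+_ (ℤ.*-identityʳ (ℤ.+ m)) (ℤ.*-identityʳ (ℤ.+ n))))))

ℚ[]-* : ∀ m n → ℚ[ m ℕ.* n ] ≃ ℚ[ m ] * ℚ[ n ]
ℚ[]-* m n = ≃-reflexive (cong (λ k → mkℚᵘ k 0) (ℤ.pos-* m n))

p≤1⇒p*q≤q : ∀ {p} q .{{_ : NonNegative q}} → p ≤ 1ℚᵘ → p * q ≤ q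
p≤1⇒p*q≤q q p≤1 = ≤-trans (*-monoˡ-≤-nonNeg q p≤1) (≤-reflexive (*-identityˡ q))

p≤½⇒½≤1-p : ∀ {p} → p ≤ ½ → ½ ≤ 1ℚᵘ - p
p≤½⇒½≤1-p p≤½ = ≤-trans (≤ᵇ⇒≤ {½} {1ℚᵘ - ½} _) (+-monoʳ-≤ 1ℚᵘ (neg-mono-≤ p≤½))

½≤p⇒p*q≤r⇒q≤2*r : ∀ {p q r} .{{_ : NonNegative q}} → ½ ≤ p → p * q ≤ r → q ≤ ℚ[ 2 ] * r
½≤p⇒p*q≤r⇒q≤2*r {p} {q} {r} ½≤p pq≤r = begin
  q                  ≃⟨ ≃-sym (*-identityˡ q) ⟩
  1ℚᵘ * q            ≃⟨ *-congʳ {q} {1ℚᵘ} {ℚ[ 2 ] * ½} (*≡* refl) ⟩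
  (ℚ[ 2 ] * ½) * q   ≃⟨ *-assoc ℚ[ 2 ] ½ q ⟩
  ℚ[ 2 ] * (½ * q)   ≤⟨ *-monoʳ-≤-nonNeg ℚ[ 2 ] (*-monoˡ-≤-nonNeg q ½≤p) ⟩
  ℚ[ 2 ] * (p * q)   ≤⟨ *-monoʳ-≤-nonNeg ℚ[ 2 ] pq≤r ⟩
  ℚ[ 2 ] * r         ∎
  where open ≤-Reasoning

-- For C ≥ 0 we have C ≤ ∣ ↥ C ∣, so C * threshold C ≤ ∣ ↥ C ∣ / (2 ∣ ↥ C ∣ + 2) < ½.
threshold : ℚᵘ → ℚᵘ
threshold C = ℤ.+ 1 / (2 ℕ.* ℕ.suc ℤ.∣ ↥ C ∣)

0<threshold : ∀ C → 0ℚᵘ < threshold C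
0<threshold C = *<* (ℤ.+<+ (ℕ.s≤s ℕ.z≤n))

≤threshold⇒≤1 : ∀ {C ε} → ε ≤ threshold C → ε ≤ 1ℚᵘ
≤threshold⇒≤1 ε≤ε₀ = ≤-trans ε≤ε₀ (*≤* (ℤ.+≤+ (ℕ.s≤s ℕ.z≤n)))

*threshold≤½ : ∀ C → 0ℚᵘ ≤ C → C * threshold C ≤ ½
*threshold≤½ (mkℚᵘ (ℤ.+ p) q) _ = *≤* cross-multiplied
  where
  2p≤[1+q]*[2+2p] : p ℕ.* 2 ℕ.≤ ℕ.suc q ℕ.* (2 ℕ.* ℕ.suc p)
  2p≤[1+q]*[2+2p] = ℕ.≤-trans (ℕ.≤-reflexive (ℕ.*-comm p 2))
    (ℕ.≤-trans (ℕ.*-monoʳ-≤ 2 (ℕ.n≤1+n p)) (ℕ.m≤n*m _ (ℕ.suc q)))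
  cross-multiplied : (ℤ.+ p ℤ.* ℤ.+ 1) ℤ.* ℤ.+ 2 ℤ.≤ ℤ.+ 1 ℤ.* ℤ.+ (ℕ.suc q ℕ.* (2 ℕ.* ℕ.suc p))
  cross-multiplied rewrite ℤ.*-identityʳ (ℤ.+ p) | ℤ.*-identityˡ (ℤ.+ (ℕ.suc q ℕ.* (2 ℕ.* ℕ.suc p)))
    | sym (ℤ.pos-* p 2) = ℤ.+≤+ 2p≤[1+q]*[2+2p]
*threshold≤½ (mkℚᵘ ℤ.-[1+ _ ] _) (*≤* ())

≤threshold⇒*≤½ : ∀ {C ε} → 0ℚᵘ ≤ C → ε ≤ threshold C → C * ε ≤ ½
≤threshold⇒*≤½ {C} 0≤C ε≤ε₀ =
  ≤-trans (*-monoʳ-≤-nonNeg C {{nonNegative 0≤C}} ε≤ε₀) (*threshold≤½ C 0≤C)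

∣p∪q∣≤∣p∣+∣q∣ : ∀ {n} (p q : Subset n) → ∣ p ∪ q ∣ ℕ.≤ ∣ p ∣ ℕ.+ ∣ q ∣
∣p∪q∣≤∣p∣+∣q∣ []          []          = ℕ.z≤n
∣p∪q∣≤∣p∣+∣q∣ (true ∷ p)  (true ∷ q)  = ℕ.s≤s (ℕ.≤-trans (∣p∪q∣≤∣p∣+∣q∣ p q) (ℕ.+-monoʳ-≤ ∣ p ∣ (ℕ.n≤1+n ∣ q ∣)))
∣p∪q∣≤∣p∣+∣q∣ (true ∷ p)  (false ∷ q) = ℕ.s≤s (∣p∪q∣≤∣p∣+∣q∣ p q)
∣p∪q∣≤∣p∣+∣q∣ (false ∷ p) (true ∷ q)  = ℕ.≤-trans (ℕ.s≤s (∣p∪q∣≤∣p∣+∣q∣ p q)) (ℕ.≤-reflexive (sym (ℕ.+-suc ∣ p ∣ ∣ q ∣)))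
∣p∪q∣≤∣p∣+∣q∣ (false ∷ p) (false ∷ q) = ∣p∪q∣≤∣p∣+∣q∣ p q

∣p∣≡∣p∩q∣+∣p─q∣ : ∀ {n} (p q : Subset n) → ∣ p ∣ ≡ ∣ p ∩ q ∣ ℕ.+ ∣ p ─ q ∣
∣p∣≡∣p∩q∣+∣p─q∣ []          []          = refl
∣p∣≡∣p∩q∣+∣p─q∣ (true ∷ p)  (true ∷ q)  = cong ℕ.suc (∣p∣≡∣p∩q∣+∣p─q∣ p q)
∣p∣≡∣p∩q∣+∣p─q∣ (true ∷ p)  (false ∷ q) = trans (cong ℕ.suc (∣p∣≡∣p∩q∣+∣p─q∣ p q)) (sym (ℕ.+-suc ∣ p ∩ q ∣ ∣ p ─ q ∣))
∣p∣≡∣p∩q∣+∣p─q∣ (false ∷ p) (true ∷ q)  = ∣p∣≡∣p∩q∣+∣p─q∣ p q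
∣p∣≡∣p∩q∣+∣p─q∣ (false ∷ p) (false ∷ q) = ∣p∣≡∣p∩q∣+∣p─q∣ p q

x∈p⇒0<∣p∣ : ∀ {n} {x : Fin n} {p : Subset n} → x ∈ p → 0 ℕ.< ∣ p ∣
x∈p⇒0<∣p∣ {x = x} {p} x∈p = subst (ℕ._≤ ∣ p ∣) (∣⁅x⁆∣≡1 x)
  (p⊆q⇒∣p∣≤∣q∣ (λ y∈⁅x⁆ → subst (_∈ p) (sym (x∈⁅y⁆⇒x≡y x y∈⁅x⁆)) x∈p))

∈-tabulate⁻ : ∀ {n} (f : Fin n → Bool) {w} → w ∈ tabulate f → f w ≡ true
∈-tabulate⁻ f {w} w∈ = trans (sym (lookup∘tabulate f w)) ([]=⇒lookup w∈)

foldr-∧-true⁻ : ∀ {A : Set} (g : A → Bool) (xs : List A) →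
  foldr (λ u b → g u ∧ b) true xs ≡ true → ∀ {u} → u ∈ₗ xs → g u ≡ true
foldr-∧-true⁻ g (x List.∷ xs) all-true u∈ with g x in gx
foldr-∧-true⁻ g (x List.∷ xs) all-true (here refl) | true = gx
foldr-∧-true⁻ g (x List.∷ xs) all-true (there u∈) | true = foldr-∧-true⁻ g xs all-true u∈

module _ {n} (P : Preclustering n) where

  interAdm⊆adm : ∀ r → interAdm P r ⊆ adm P r
  interAdm⊆adm r {w} w∈ = lookup⇒[]= w (adm P r)
    (subst (λ b → not b ∨ lookup (adm P r) w ≡ true) ([]=⇒lookup (atom-self P r)) clause-r)
    where
    clause-r : not (lookup (atom P r) r) ∨ lookup (adm P r) w ≡ true
    clause-r = foldr-∧-true⁻ _ (allFin n) (∈-tabulate⁻ _ w∈) (∈-allFin r)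

  cand-cases : ∀ {r v} → v ∈ cand P r → (inVKᵇ P r ≡ true × v ∈ atom P r) ⊎ v ∈ adm P r
  cand-cases {r} v∈ with inVKᵇ P r
  ... | false = inj₂ (p─q⊆p (adm P r) (VK P) v∈)
  ... | true with x∈p∪q⁻ (atom P r) (interAdm P r) v∈
  ...   | inj₁ v∈K = inj₁ (refl , v∈K)
  ...   | inj₂ v∈I = inj₂ (interAdm⊆adm r v∈I)

  ∣cand∣≤∣atom∣+d-adm : ∀ r → ∣ cand P r ∣ ℕ.≤ ∣ atom P r ∣ ℕ.+ d-adm P r
  ∣cand∣≤∣atom∣+d-adm r with inVKᵇ P r
  ... | false = ℕ.≤-trans (∣p─q∣≤∣p∣ (adm P r) (VK P)) (ℕ.m≤n+m _ _)
  ... | true  = ℕ.≤-trans (∣p∪q∣≤∣p∣+∣q∣ (atom P r) (interAdm P r))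
                  (ℕ.+-monoʳ-≤ _ (p⊆q⇒∣p∣≤∣q∣ (interAdm⊆adm r)))

module _ {n} {G : Instance n} {P : Preclustering n} {C ε : ℚᵘ} (S : EpsSimilar G P C ε)
         (0≤ε : 0ℚᵘ ≤ ε) (ε≤1 : ε ≤ 1ℚᵘ) (Cε≤½ : C * ε ≤ ½) where

  open EpsSimilar S
  open Instance G

  instance
    ε-nonNeg : NonNegative ε
    ε-nonNeg = nonNegative 0≤ε

  ∣atom∣≤2*deg : ∀ v → ∣ atom P v ∣ ℕ.≤ 2 ℕ.* deg G v
  ∣atom∣≤2*deg v with inVKᵇ P v in v∈VK
  ... | true = ℚ[]-cancel-≤ (begin
    ℚ[ ∣ atom P v ∣ ]     ≤⟨ ½≤p⇒p*q≤r⇒q≤2*r (p≤½⇒½≤1-p Cε≤½) (≤-trans (condC₁ v v∈VK) inside≤deg) ⟩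
    ℚ[ 2 ] * ℚ[ deg G v ] ≃⟨ ℚ[]-* 2 (deg G v) ⟨
    ℚ[ 2 ℕ.* deg G v ]    ∎)
    where
    open ≤-Reasoning
    inside≤deg : ℚ[ ∣ plus v ∩ atom P v ∣ ] ≤ ℚ[ deg G v ]
    inside≤deg = ℚ[]-mono-≤ (∣p∩q∣≤∣p∣ (plus v) (atom P v))
  ... | false = ℕ.≤-trans ∣atom∣≤1 (ℕ.≤-trans (x∈p⇒0<∣p∣ (plus-refl v)) (ℕ.m≤n*m (deg G v) 2))
    where
    ∣atom∣≤1 : ∣ atom P v ∣ ℕ.≤ 1
    ∣atom∣≤1 = ℕ.s≤s⁻¹ (ℕ.≰⇒> (λ 2≤∣atom∣ → subst T v∈VK (ℕ.≤⇒≤ᵇ 2≤∣atom∣)))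

  deg≤2*∣atom∣ : ∀ v → inVKᵇ P v ≡ true → deg G v ℕ.≤ 2 ℕ.* ∣ atom P v ∣
  deg≤2*∣atom∣ v v∈VK = begin
    deg G v                                       ≡⟨ ∣p∣≡∣p∩q∣+∣p─q∣ (plus v) (atom P v) ⟩
    ∣ plus v ∩ atom P v ∣ ℕ.+ ∣ plus v ─ atom P v ∣ ≤⟨ ℕ.+-mono-≤ (∣p∩q∣≤∣q∣ (plus v) (atom P v)) outside≤∣atom∣ ⟩
    ∣ atom P v ∣ ℕ.+ ∣ atom P v ∣                   ≡⟨ cong (∣ atom P v ∣ ℕ.+_) (sym (ℕ.+-identityʳ _)) ⟩
    2 ℕ.* ∣ atom P v ∣                            ∎
    where
    open ℕ.≤-Reasoning
    outside≤∣atom∣ : ∣ plus v ─ atom P v ∣ ℕ.≤ ∣ atom P v ∣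
    outside≤∣atom∣ = ℚ[]-cancel-≤ (≤-trans (condC₂ v v∈VK)
      (p≤1⇒p*q≤q ℚ[ ∣ atom P v ∣ ] (≤-trans Cε≤½ (≤ᵇ⇒≤ {½} {1ℚᵘ} _))))

  ε³ : ℚᵘ
  ε³ = ε * ε * ε

  ε³≤1 : ε³ ≤ 1ℚᵘ
  ε³≤1 = ≤-trans (p≤1⇒p*q≤q ε (≤-trans (p≤1⇒p*q≤q ε ε≤1) ε≤1)) ε≤1

  instance
    ε³-nonNeg : NonNegative ε³
    ε³-nonNeg = nonNeg*nonNeg⇒nonNeg (ε * ε) {{nonNeg*nonNeg⇒nonNeg ε ε}} ε

  ε³∣cand∣≤4*deg : ∀ r → ε³ * ℚ[ ∣ cand P r ∣ ] ≤ ℚ[ 4 ] * ℚ[ deg G r ]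
  ε³∣cand∣≤4*deg r = begin
    ε³ * ℚ[ ∣ cand P r ∣ ]            ≤⟨ *-monoʳ-≤-nonNeg ε³ (ℚ[]-mono-≤ (∣cand∣≤∣atom∣+d-adm P r)) ⟩
    ε³ * ℚ[ K ℕ.+ A ]                 ≃⟨ *-congˡ {ε³} (ℚ[]-+ K A) ⟩
    ε³ * (ℚ[ K ] + ℚ[ A ])            ≃⟨ *-distribˡ-+ ε³ ℚ[ K ] ℚ[ A ] ⟩
    ε³ * ℚ[ K ] + ε³ * ℚ[ A ]         ≤⟨ +-mono-≤ (p≤1⇒p*q≤q ℚ[ K ] ε³≤1) (condA r) ⟩
    ℚ[ K ] + ℚ[ 2 ] * ℚ[ d ]          ≤⟨ +-monoˡ-≤ (ℚ[ 2 ] * ℚ[ d ]) (ℚ[]-mono-≤ (∣atom∣≤2*deg r)) ⟩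
    ℚ[ 2 ℕ.* d ] + ℚ[ 2 ] * ℚ[ d ]    ≃⟨ +-congˡ (ℚ[ 2 ] * ℚ[ d ]) (ℚ[]-* 2 d) ⟩
    ℚ[ 2 ] * ℚ[ d ] + ℚ[ 2 ] * ℚ[ d ] ≃⟨ ≃-sym (*-distribʳ-+ ℚ[ d ] ℚ[ 2 ] ℚ[ 2 ]) ⟩
    (ℚ[ 2 ] + ℚ[ 2 ]) * ℚ[ d ]        ≃⟨ *-congʳ {ℚ[ d ]} (≃-sym (ℚ[]-+ 2 2)) ⟩
    ℚ[ 4 ] * ℚ[ d ]                   ∎
    where
    open ≤-Reasoning
    K = ∣ atom P r ∣
    A = d-adm P r
    d = deg G r

  ε*deg≤4*deg : ∀ {r v} → v ∈ cand P r → ε * ℚ[ deg G r ] ≤ ℚ[ 4 ] * ℚ[ deg G v ]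
  ε*deg≤4*deg {r} {v} v∈ with cand-cases P v∈
  ... | inj₂ v∈adm = ≤-trans (condB₁ r v (adm-sym P v r v∈adm))
                       (*-monoˡ-≤-nonNeg ℚ[ deg G v ] (ℚ[]-mono-≤ {2} {4} (ℕ.s≤s (ℕ.s≤s ℕ.z≤n))))
  ... | inj₁ (r∈VK , v∈atom) = begin
    ε * ℚ[ deg G r ]              ≤⟨ p≤1⇒p*q≤q ℚ[ deg G r ] ε≤1 ⟩
    ℚ[ deg G r ]                  ≤⟨ ℚ[]-mono-≤ deg-r≤4*deg-v ⟩
    ℚ[ 4 ℕ.* deg G v ]            ≃⟨ ℚ[]-* 4 (deg G v) ⟩
    ℚ[ 4 ] * ℚ[ deg G v ]         ∎
    where
    open ≤-Reasoning
    deg-r≤4*deg-v : deg G r ℕ.≤ 4 ℕ.* deg G v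
    deg-r≤4*deg-v = ℕ.≤-trans (deg≤2*∣atom∣ r r∈VK) (ℕ.≤-trans
      (ℕ.*-monoʳ-≤ 2 (subst (λ a → ∣ a ∣ ℕ.≤ 2 ℕ.* deg G v) (atom-cons P v r v∈atom) (∣atom∣≤2*deg v)))
      (ℕ.≤-reflexive (sym (ℕ.*-assoc 2 2 (deg G v)))))

  ε⁴∣cand∣≤16*deg : ∀ {r v} → v ∈ cand P r → ε³ * ε * ℚ[ ∣ cand P r ∣ ] ≤ ℚ[ 16 ] * ℚ[ deg G v ]
  ε⁴∣cand∣≤16*deg {r} {v} v∈ = begin
    (ε³ * ε) * ℚ[ ∣ cand P r ∣ ]     ≃⟨ xy∙z≈y∙xz ε³ ε ℚ[ ∣ cand P r ∣ ] ⟩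
    ε * (ε³ * ℚ[ ∣ cand P r ∣ ])     ≤⟨ *-monoʳ-≤-nonNeg ε (ε³∣cand∣≤4*deg r) ⟩
    ε * (ℚ[ 4 ] * ℚ[ deg G r ])      ≃⟨ x∙yz≈y∙xz ε ℚ[ 4 ] ℚ[ deg G r ] ⟩
    ℚ[ 4 ] * (ε * ℚ[ deg G r ])      ≤⟨ *-monoʳ-≤-nonNeg ℚ[ 4 ] (ε*deg≤4*deg v∈) ⟩
    ℚ[ 4 ] * (ℚ[ 4 ] * ℚ[ deg G v ]) ≃⟨ ≃-sym (*-assoc ℚ[ 4 ] ℚ[ 4 ] ℚ[ deg G v ]) ⟩
    (ℚ[ 4 ] * ℚ[ 4 ]) * ℚ[ deg G v ] ≃⟨ *-congʳ {ℚ[ deg G v ]} (≃-sym (ℚ[]-* 4 4)) ⟩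
    ℚ[ 16 ] * ℚ[ deg G v ]           ∎
    where open ≤-Reasoning

lemma5p2 : (C : ℚᵘ) → 0ℚᵘ ≤ C →
    Σ ℚᵘ λ ε₀ → 0ℚᵘ < ε₀ × Σ ℕ λ D →
      (ε : ℚᵘ) → 0ℚᵘ < ε → ε ≤ ε₀ →
      (n : ℕ) (G : Instance n) (P : Preclustering n) → EpsSimilar G P C ε →
      (r v : Fin n) → v ∈ cand P r →
      ε * ε * ε * ε * ℚ[ ∣ cand P r ∣ ] ≤ ℚ[ D ] * ℚ[ deg G v ]
lemma5p2 C 0≤C = threshold C , 0<threshold C , 16 , λ ε 0<ε ε≤ε₀ _ _ _ S _ _ →
  ε⁴∣cand∣≤16*deg S (<⇒≤ 0<ε) (≤threshold⇒≤1 {C} ε≤ε₀) (≤threshold⇒*≤½ 0≤C ε≤ε₀)
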